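{- For $n\ge1$ and all $f,g$, $(gD_q)^nf=\sum_{k=1}^nL_{n,k}(q)\,f_k^{(n-k)}$, where $$L_{n,k}(q)=\frac{g_0^{(0)}}{[k]_q!}\sum[2-K_1]_q[3-K_2]_q\cdots[n-K_{n-1}]_q\,\frac{g_{k_1}^{(0)}}{[k_1]_q!}\frac{g_{k_2}^{(K_1)}}{[k_2]_q!}\cdots\frac{g_{k_{n-1}}^{(K_{n-2})}}{[k_{n-1}]_q!},$$ the sum running over all sequences $(k_1,\dots,k_{n-1})$ of nonnegative integers with $k_1+\cdots+k_{n-1}=n-k$ and $K_j:=k_1+\cdots+k_j\le j$ for all $1\le j\le n-1$.
   Context: Let $f,g$ be formal power series in $x$ (coefficients in a field containing the indeterminate $q$). $D_qh(x)=\frac{h(x)-h(xq)}{x-xq}$; $(gD_q)$ is the operator $h\mapsto g\cdot D_qh$. For $i,j\ge0$, $f_i^{(j)}(x)=(D_q^if)(q^jx)$ and $g_i^{(j)}(x)=(D_q^ig)(q^jx)$. $[m]_q=1+q+\dots+q^{m-1}$ ($[0]_q=0$), $[m]_q!=[1]_q\cdots[m]_q$, $[0]_q!=1$. -}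

module Defs where

open import Level using (Level; _⊔_) renaming (suc to lsuc)
open import Algebra.Bundles using (CommutativeRing)
open import Data.Nat as ℕ using (ℕ; zero; suc; _∸_; _≤ᵇ_; _≡ᵇ_)
open import Data.Bool using (Bool; true; false; _∧_)
open import Data.List as List using (List; []; _∷_; filterᵇ; concatMap; upTo)
open import Data.Vec as Vec using (Vec; []; _∷_)
open import Relation.Nullary using (¬_)

record Field (c ℓ : Level) : Set (lsuc (c ⊔ ℓ)) where
  field
    commutativeRing : CommutativeRing c ℓ
  open CommutativeRing commutativeRing public
  field
    _⁻¹      : Carrier → Carrier
    1≉0      : ¬ (1# ≈ 0#)
    inverseʳ : ∀ x → ¬ (x ≈ 0#) → x * (x ⁻¹) ≈ 1#

module PowerSeries {c ℓ : Level} (F : Field c ℓ) (q : Field.Carrier F) where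
  open Field F

  -- power series h = Σ_m (h m) x^m
  PS : Set c
  PS = ℕ → Carrier

  _≋_ : PS → PS → Set ℓ
  h ≋ k = ∀ m → h m ≈ k m

  pow : Carrier → ℕ → Carrier
  pow a zero    = 1#
  pow a (suc m) = a * pow a m

  sumF : ℕ → (ℕ → Carrier) → Carrier
  sumF zero    a = 0#
  sumF (suc m) a = sumF m a + a m

  [_]q : ℕ → Carrier
  [ m ]q = sumF m (pow q)

  [_]q! : ℕ → Carrier
  [ zero  ]q! = 1#
  [ suc m ]q! = [ suc m ]q * [ m ]q!

  0ₛ : PS
  0ₛ m = 0#

  1ₛ : PS
  1ₛ zero    = 1#
  1ₛ (suc m) = 0#

  _+ₛ_ : PS → PS → PS
  (h +ₛ k) m = h m + k m

  _·ₛ_ : PS → PS → PS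
  (h ·ₛ k) m = sumF (suc m) (λ i → h i * k (m ∸ i))

  _⊙_ : Carrier → PS → PS
  (a ⊙ h) m = a * h m

  sumₛ : ℕ → (ℕ → PS) → PS
  sumₛ zero    h = 0ₛ
  sumₛ (suc m) h = sumₛ m h +ₛ h m

  sumList : List PS → PS
  sumList []       = 0ₛ
  sumList (h ∷ hs) = h +ₛ sumList hs

  -- dilation: h ↦ h(a x)
  dil : Carrier → PS → PS
  dil a h m = pow a m * h m

  -- q-derivative D_q h(x) = (h(x) - h(xq)) / (x - xq):
  -- the series h(x) - h(qx) has zero constant term; its coefficient of
  -- x^{m+1} is h_{m+1} - q^{m+1} h_{m+1}; dividing by x(1 - q) gives
  Dq : PS → PS
  Dq h m = (h (suc m) - pow q (suc m) * h (suc m)) * ((1# - q) ⁻¹)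

  Dq^ : ℕ → PS → PS
  Dq^ zero    h = h
  Dq^ (suc i) h = Dq (Dq^ i h)

  -- h_i^{(j)}(x) = (D_q^i h)(q^j x)
  _⟨_,_⟩ : PS → ℕ → ℕ → PS
  h ⟨ i , j ⟩ = dil (pow q j) (Dq^ i h)

  gDq : PS → PS → PS
  gDq g h = g ·ₛ Dq h

  gDq^ : ℕ → PS → PS → PS
  gDq^ zero    g h = h
  gDq^ (suc n) g h = gDq g (gDq^ n g h)

  allVecs : ℕ → (m : ℕ) → List (Vec ℕ m)
  allVecs N zero    = [] ∷ []
  allVecs N (suc m) =
    concatMap (λ k → List.map (k ∷_) (allVecs N m)) (upTo (suc N))

  vsum : ∀ {m} → Vec ℕ m → ℕ
  vsum []       = 0
  vsum (k ∷ ks) = k ℕ.+ vsum ks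

  -- prefixOK j K ks : for the remaining entries, the partial sums
  -- K_j = K_{j-1} + k_j satisfy K_j ≤ j (K = K_{j-1}, first remaining index j)
  prefixOK : ∀ {m} → ℕ → ℕ → Vec ℕ m → Bool
  prefixOK j K []       = true
  prefixOK j K (k ∷ ks) = ((K ℕ.+ k) ≤ᵇ j) ∧ prefixOK (suc j) (K ℕ.+ k) ks

  admissible : ℕ → ℕ → ∀ {m} → Vec ℕ m → Bool
  admissible n k ks = (vsum ks ≡ᵇ (n ∸ k)) ∧ prefixOK 1 0 ks

  -- the set of admissible sequences, as a duplicate-free list.
  -- Entries of an admissible sequence are ≤ n - k ≤ n, so enumerating
  -- entries in {0..n} is exhaustive.
  admissibleSeqs : (n k : ℕ) → List (Vec ℕ (n ∸ 1))
  admissibleSeqs n k = filterᵇ (admissible n k) (allVecs n (n ∸ 1))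

  -- summand for a sequence, with g fixed:
  --   Π_{j} [j+1-K_j]_q · g_{k_j}^{(K_{j-1})} / [k_j]_q!
  -- term j K ks : product over remaining entries, j = index of first one,
  -- K = K_{j-1}
  term : PS → ∀ {m} → ℕ → ℕ → Vec ℕ m → PS
  term g j K []       = 1ₛ
  term g j K (k ∷ ks) =
    (([ suc j ∸ (K ℕ.+ k) ]q * ([ k ]q! ⁻¹)) ⊙ (g ⟨ k , K ⟩))
      ·ₛ term g (suc j) (K ℕ.+ k) ks

  L : PS → ℕ → ℕ → PS
  L g n k =
    ([ k ]q! ⁻¹) ⊙ ((g ⟨ 0 , 0 ⟩) ·ₛ sumList (List.map (term g 1 0) (admissibleSeqs n k)))

{-# OPTIONS --safe #-}
module Submission where

-- Write h⟪a,c⟫ for h_a^{(c)} / [a]_q!.  Iterating the q-Leibniz rule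
-- D_q(uv) = D_q u · v(qx) + u · D_q v with the q-Pascal identity [k]_q + q^k [b-k]_q = [b]_q gives
-- D_q^a(uv)/[a]_q! = Σ_{k≤a} (D_q^k u/[k]_q!) · (D_q^{a-k} v/[a-k]_q!)(q^k x), and for (g D_q) h = g · D_q h
-- this becomes the recurrence  ((g D_q) h)⟪a,c⟫ = Σ_{k≤a} [a-k+1]_q g⟪k,c⟫ · h⟪a-k+1, c+k⟫.
-- Start from (g D_q)^n f = g · ((g D_q)^{n-1} f)⟪1,0⟫ and unfold the recurrence n-1 times: at step j
-- the state is (a, c) = (j - K_{j-1}, K_{j-1}), the choice k = k_j is allowed exactly when K_j ≤ j,
-- and it contributes [j+1-K_j]_q g⟪k_j, K_{j-1}⟫.  The factor left at the end is f⟪n - K_{n-1}, K_{n-1}⟫,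
-- so grouping the admissible sequences by k = n - K_{n-1} gives L_{n,k}.

open import Defs
open import Level using (Level)
open import Data.Nat using (ℕ; suc; _∸_; _≤_)
open import Relation.Nullary using (¬_)

open import Algebra.Bundles.Raw using (RawMonoid)
open import Algebra.Morphism.Structures using (module MonoidMorphisms)
import Algebra.Properties.CommutativeSemigroup as CommSemigroupProperties
import Algebra.Properties.Group as GroupProperties
import Algebra.Properties.Ring as RingProperties
open import Data.Bool using (Bool; true; false; if_then_else_; _∧_; T)
open import Data.Bool.Properties using (T-∧; ∧-identityʳ; ∧-zeroʳ)
open import Data.Empty using (⊥-elim)
open import Data.List as List using (List; []; _∷_)
open import Data.Nat as ℕ using (zero; _<_; z≤n; s≤s; _≤′_; ≤′-refl; ≤′-step; _≤ᵇ_; _≡ᵇ_)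
import Data.Nat.Properties as ℕₚ
open import Data.Product using (_,_)
open import Data.Vec using (Vec; []; _∷_)
open import Function.Bundles using (Equivalence)
open import Relation.Binary.Bundles using (Setoid)
open import Relation.Binary.PropositionalEquality as ≡ using (_≡_; _≢_)
import Relation.Binary.Reasoning.Setoid as SetoidReasoning
open import Relation.Binary.Structures using (IsEquivalence)

module FieldProperties {c ℓ : Level} (F : Field c ℓ) where
  open Field F
  open SetoidReasoning setoid

  ⁻¹-inverseˡ : ∀ {x} → ¬ x ≈ 0# → x ⁻¹ * x ≈ 1#
  ⁻¹-inverseˡ {x} x≉0 = trans (*-comm _ _) (inverseʳ x x≉0)

  ⁻¹-cancelˡ : ∀ {x} y → ¬ x ≈ 0# → x ⁻¹ * (x * y) ≈ y
  ⁻¹-cancelˡ {x} y x≉0 = begin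
    x ⁻¹ * (x * y)  ≈⟨ *-assoc _ _ _ ⟨
    x ⁻¹ * x * y    ≈⟨ *-congʳ (⁻¹-inverseˡ x≉0) ⟩
    1# * y          ≈⟨ *-identityˡ y ⟩
    y               ∎

  *-cancelˡ : ∀ {x y z} → ¬ x ≈ 0# → x * y ≈ x * z → y ≈ z
  *-cancelˡ {x} {y} {z} x≉0 xy≈xz = begin
    y               ≈⟨ ⁻¹-cancelˡ y x≉0 ⟨
    x ⁻¹ * (x * y)  ≈⟨ *-congˡ xy≈xz ⟩
    x ⁻¹ * (x * z)  ≈⟨ ⁻¹-cancelˡ z x≉0 ⟩
    z               ∎

  -- Field does not make _⁻¹ a congruence, so every equation between inverses goes through ⁻¹-unique.
  ⁻¹-unique : ∀ {x y} → ¬ x ≈ 0# → x * y ≈ 1# → y ≈ x ⁻¹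
  ⁻¹-unique {x} x≉0 xy≈1 = *-cancelˡ x≉0 (trans xy≈1 (sym (inverseʳ x x≉0)))

  *-nonzero : ∀ {x y} → ¬ x ≈ 0# → ¬ y ≈ 0# → ¬ x * y ≈ 0#
  *-nonzero {x} x≉0 y≉0 xy≈0 = y≉0 (*-cancelˡ x≉0 (trans xy≈0 (sym (zeroʳ x))))

  1⁻¹≈1 : 1# ⁻¹ ≈ 1#
  1⁻¹≈1 = sym (⁻¹-unique 1≉0 (*-identityˡ 1#))

module FiniteSums {c ℓ : Level} (F : Field c ℓ) (q : Field.Carrier F) where
  open Field F
  open PowerSeries F q
  open CommSemigroupProperties +-commutativeSemigroup using (interchange)
  open SetoidReasoning setoid

  sumF-cong : ∀ m {a b : ℕ → Carrier} → (∀ i → i < m → a i ≈ b i) → sumF m a ≈ sumF m b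
  sumF-cong zero    a≈b = refl
  sumF-cong (suc m) a≈b = +-cong (sumF-cong m (λ i i<m → a≈b i (ℕₚ.m<n⇒m<1+n i<m))) (a≈b m ℕₚ.≤-refl)

  sumF-zero : ∀ m {a : ℕ → Carrier} → (∀ i → a i ≈ 0#) → sumF m a ≈ 0#
  sumF-zero zero    a≈0 = refl
  sumF-zero (suc m) a≈0 = trans (+-cong (sumF-zero m a≈0) (a≈0 m)) (+-identityˡ 0#)

  sumF-distrib-+ : ∀ m (a b : ℕ → Carrier) → sumF m (λ i → a i + b i) ≈ sumF m a + sumF m b
  sumF-distrib-+ zero    a b = sym (+-identityˡ 0#)
  sumF-distrib-+ (suc m) a b = trans (+-congʳ (sumF-distrib-+ m a b)) (interchange _ _ _ _)

  *-distribˡ-sumF : ∀ m x (a : ℕ → Carrier) → x * sumF m a ≈ sumF m (λ i → x * a i)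
  *-distribˡ-sumF zero    x a = zeroʳ x
  *-distribˡ-sumF (suc m) x a = trans (distribˡ _ _ _) (+-congʳ (*-distribˡ-sumF m x a))

  *-distribʳ-sumF : ∀ m x (a : ℕ → Carrier) → sumF m a * x ≈ sumF m (λ i → a i * x)
  *-distribʳ-sumF zero    x a = zeroˡ x
  *-distribʳ-sumF (suc m) x a = trans (distribʳ _ _ _) (+-congʳ (*-distribʳ-sumF m x a))

  sumF-suc : ∀ m (a : ℕ → Carrier) → sumF (suc m) a ≈ a 0 + sumF m (λ i → a (suc i))
  sumF-suc zero    a = trans (+-identityˡ _) (sym (+-identityʳ _))
  sumF-suc (suc m) a = trans (+-congʳ (sumF-suc m a)) (+-assoc _ _ _)

  sumF-triangle : ∀ m (G : ℕ → ℕ → Carrier) →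
    sumF (suc m) (λ i → sumF (suc (m ∸ i)) (G i)) ≈ sumF (suc m) (λ s → sumF (suc s) (λ i → G i (s ∸ i)))
  sumF-triangle zero    G = refl
  sumF-triangle (suc m) G = begin
    sumF (suc (suc m)) (λ i → sumF (suc (suc m ∸ i)) (G i))
      ≈⟨ sumF-suc (suc m) _ ⟩
    sumF (suc (suc m)) (G 0) + sumF (suc m) (λ i → sumF (suc (m ∸ i)) (G (suc i)))
      ≈⟨ +-congˡ (sumF-triangle m (λ i → G (suc i))) ⟩
    sumF (suc (suc m)) (G 0) + sumF (suc m) (λ s → sumF (suc s) (λ i → G (suc i) (s ∸ i)))
      ≈⟨ +-congˡ (trans (sumF-suc (suc m) _) (+-identityˡ _)) ⟨
    sumF (suc (suc m)) (G 0) + sumF (suc (suc m)) (λ s → sumF s (λ i → G (suc i) (s ∸ suc i)))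
      ≈⟨ sumF-distrib-+ (suc (suc m)) _ _ ⟨
    sumF (suc (suc m)) (λ s → G 0 s + sumF s (λ i → G (suc i) (s ∸ suc i)))
      ≈⟨ sumF-cong (suc (suc m)) (λ s _ → sumF-suc s _) ⟨
    sumF (suc (suc m)) (λ s → sumF (suc s) (λ i → G i (s ∸ i)))
      ∎

module QIntegers {c ℓ : Level} (F : Field c ℓ) (q : Field.Carrier F) where
  open Field F
  open PowerSeries F q
  open FiniteSums F q
  open CommSemigroupProperties *-commutativeSemigroup using () renaming (interchange to *-interchange)
  open RingProperties ring using (x[y-z]≈xy-xz)
  open SetoidReasoning setoid

  pow-cong : ∀ {x y} m → x ≈ y → pow x m ≈ pow y m
  pow-cong zero    x≈y = refl
  pow-cong (suc m) x≈y = *-cong x≈y (pow-cong m x≈y)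

  pow-+ : ∀ x i j → pow x (i ℕ.+ j) ≈ pow x i * pow x j
  pow-+ x zero    j = sym (*-identityˡ _)
  pow-+ x (suc i) j = trans (*-congˡ (pow-+ x i j)) (sym (*-assoc _ _ _))

  pow-distrib-* : ∀ x y m → pow (x * y) m ≈ pow x m * pow y m
  pow-distrib-* x y zero    = sym (*-identityˡ 1#)
  pow-distrib-* x y (suc m) = trans (*-congˡ (pow-distrib-* x y m)) (*-interchange _ _ _ _)

  pow-1 : ∀ m → pow 1# m ≈ 1#
  pow-1 zero    = refl
  pow-1 (suc m) = trans (*-identityˡ _) (pow-1 m)

  [suc]q : ∀ n → [ suc n ]q ≈ 1# + q * [ n ]q
  [suc]q n = trans (sumF-suc n (pow q)) (+-congˡ (sym (*-distribˡ-sumF n q (pow q))))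

  [+]q : ∀ i j → [ i ℕ.+ j ]q ≈ [ i ]q + pow q i * [ j ]q
  [+]q zero    j = sym (trans (+-identityˡ _) (*-identityˡ _))
  [+]q (suc i) j = begin
    [ suc (i ℕ.+ j) ]q                           ≈⟨ [suc]q (i ℕ.+ j) ⟩
    1# + q * [ i ℕ.+ j ]q                        ≈⟨ +-congˡ (*-congˡ ([+]q i j)) ⟩
    1# + q * ([ i ]q + pow q i * [ j ]q)         ≈⟨ +-congˡ (distribˡ _ _ _) ⟩
    1# + (q * [ i ]q + q * (pow q i * [ j ]q))   ≈⟨ +-assoc _ _ _ ⟨
    (1# + q * [ i ]q) + q * (pow q i * [ j ]q)   ≈⟨ +-cong ([suc]q i) (*-assoc _ _ _) ⟨
    [ suc i ]q + pow q (suc i) * [ j ]q          ∎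

  [n]q*[1-q]≈1-qⁿ : ∀ n → [ n ]q * (1# - q) ≈ 1# - pow q n
  [n]q*[1-q]≈1-qⁿ zero    = trans (zeroˡ _) (sym (-‿inverseʳ 1#))
  [n]q*[1-q]≈1-qⁿ (suc n) = begin
    ([ n ]q + pow q n) * (1# - q)                   ≈⟨ distribʳ _ _ _ ⟩
    [ n ]q * (1# - q) + pow q n * (1# - q)          ≈⟨ +-cong ([n]q*[1-q]≈1-qⁿ n) (x[y-z]≈xy-xz _ _ _) ⟩
    (1# - pow q n) + (pow q n * 1# - pow q n * q)   ≈⟨ +-congˡ (+-cong (*-identityʳ _) (-‿cong (*-comm _ _))) ⟩
    (1# - pow q n) + (pow q n - pow q (suc n))      ≈⟨ +-assoc _ _ _ ⟩
    1# + (- pow q n + (pow q n - pow q (suc n)))    ≈⟨ +-congˡ (+-assoc _ _ _) ⟨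
    1# + ((- pow q n + pow q n) - pow q (suc n))    ≈⟨ +-congˡ (+-congʳ (-‿inverseˡ _)) ⟩
    1# + (0# - pow q (suc n))                       ≈⟨ +-congˡ (+-identityˡ _) ⟩
    1# - pow q (suc n)                              ∎

module SeriesAlgebra {c ℓ : Level} (F : Field c ℓ) (q : Field.Carrier F) where
  open Field F
  open PowerSeries F q
  open FieldProperties F
  open FiniteSums F q
  open QIntegers F q
  open CommSemigroupProperties +-commutativeSemigroup using () renaming (interchange to +-interchange)
  open CommSemigroupProperties *-commutativeSemigroup using (x∙yz≈y∙xz) renaming (interchange to *-interchange)
  open SetoidReasoning setoid

  ≋-isEquivalence : IsEquivalence _≋_
  ≋-isEquivalence = record
    { refl  = λ m → refl
    ; sym   = λ h≋k m → sym (h≋k m)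
    ; trans = λ h≋k k≋l m → trans (h≋k m) (k≋l m)
    }

  ≋-setoid : Setoid c ℓ
  ≋-setoid = record { isEquivalence = ≋-isEquivalence }

  open IsEquivalence ≋-isEquivalence public
    using () renaming (refl to ≋-refl; sym to ≋-sym; trans to ≋-trans; reflexive to ≋-reflexive)

  +ₛ-cong : ∀ {h h′ k k′} → h ≋ h′ → k ≋ k′ → (h +ₛ k) ≋ (h′ +ₛ k′)
  +ₛ-cong h≋h′ k≋k′ m = +-cong (h≋h′ m) (k≋k′ m)

  +ₛ-assoc : ∀ h k l → ((h +ₛ k) +ₛ l) ≋ (h +ₛ (k +ₛ l))
  +ₛ-assoc h k l m = +-assoc _ _ _

  +ₛ-identityˡ : ∀ h → (0ₛ +ₛ h) ≋ h
  +ₛ-identityˡ h m = +-identityˡ _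

  +ₛ-identityʳ : ∀ h → (h +ₛ 0ₛ) ≋ h
  +ₛ-identityʳ h m = +-identityʳ _

  +ₛ-interchange : ∀ h k l r → ((h +ₛ k) +ₛ (l +ₛ r)) ≋ ((h +ₛ l) +ₛ (k +ₛ r))
  +ₛ-interchange h k l r m = +-interchange _ _ _ _

  ·ₛ-cong : ∀ {h h′ k k′} → h ≋ h′ → k ≋ k′ → (h ·ₛ k) ≋ (h′ ·ₛ k′)
  ·ₛ-cong h≋h′ k≋k′ m = sumF-cong (suc m) (λ i _ → *-cong (h≋h′ i) (k≋k′ (m ∸ i)))

  ·ₛ-distribˡ : ∀ h k l → (h ·ₛ (k +ₛ l)) ≋ ((h ·ₛ k) +ₛ (h ·ₛ l))
  ·ₛ-distribˡ h k l m = trans (sumF-cong (suc m) (λ i _ → distribˡ _ _ _)) (sumF-distrib-+ (suc m) _ _)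

  ·ₛ-distribʳ : ∀ h k l → ((k +ₛ l) ·ₛ h) ≋ ((k ·ₛ h) +ₛ (l ·ₛ h))
  ·ₛ-distribʳ h k l m = trans (sumF-cong (suc m) (λ i _ → distribʳ _ _ _)) (sumF-distrib-+ (suc m) _ _)

  ·ₛ-zeroˡ : ∀ h → (0ₛ ·ₛ h) ≋ 0ₛ
  ·ₛ-zeroˡ h m = sumF-zero (suc m) (λ i → zeroˡ _)

  ·ₛ-zeroʳ : ∀ h → (h ·ₛ 0ₛ) ≋ 0ₛ
  ·ₛ-zeroʳ h m = sumF-zero (suc m) (λ i → zeroʳ _)

  ·ₛ-identityˡ : ∀ h → (1ₛ ·ₛ h) ≋ h
  ·ₛ-identityˡ h m = begin
    sumF (suc m) (λ i → 1ₛ i * h (m ∸ i))          ≈⟨ sumF-suc m _ ⟩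
    1# * h m + sumF m (λ i → 0# * h (m ∸ suc i))    ≈⟨ +-cong (*-identityˡ _) (sumF-zero m (λ i → zeroˡ _)) ⟩
    h m + 0#                                        ≈⟨ +-identityʳ _ ⟩
    h m                                             ∎

  ·ₛ-assoc : ∀ h k l → ((h ·ₛ k) ·ₛ l) ≋ (h ·ₛ (k ·ₛ l))
  ·ₛ-assoc h k l m = begin
    sumF (suc m) (λ s → sumF (suc s) (λ i → h i * k (s ∸ i)) * l (m ∸ s))
      ≈⟨ sumF-cong (suc m) (λ s _ → *-distribʳ-sumF (suc s) _ _) ⟩
    sumF (suc m) (λ s → sumF (suc s) (λ i → (h i * k (s ∸ i)) * l (m ∸ s)))
      ≈⟨ sumF-cong (suc m) (λ s _ → sumF-cong (suc s) (λ i i≤s →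
           trans (*-assoc _ _ _) (*-congˡ (*-congˡ (reflexive (≡.cong l (m∸s≡m∸i∸[s∸i] (ℕₚ.≤-pred i≤s)))))))) ⟩
    sumF (suc m) (λ s → sumF (suc s) (λ i → h i * (k (s ∸ i) * l (m ∸ i ∸ (s ∸ i)))))
      ≈⟨ sumF-triangle m (λ i j → h i * (k j * l (m ∸ i ∸ j))) ⟨
    sumF (suc m) (λ i → sumF (suc (m ∸ i)) (λ j → h i * (k j * l (m ∸ i ∸ j))))
      ≈⟨ sumF-cong (suc m) (λ i _ → *-distribˡ-sumF (suc (m ∸ i)) _ _) ⟨
    sumF (suc m) (λ i → h i * sumF (suc (m ∸ i)) (λ j → k j * l (m ∸ i ∸ j)))
      ∎
    where
    m∸s≡m∸i∸[s∸i] : ∀ {i s} → i ≤ s → m ∸ s ≡ m ∸ i ∸ (s ∸ i)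
    m∸s≡m∸i∸[s∸i] {i} {s} i≤s =
      ≡.sym (≡.trans (ℕₚ.∸-+-assoc m i (s ∸ i)) (≡.cong (m ∸_) (ℕₚ.m+[n∸m]≡n i≤s)))

  ⊙-cong : ∀ {a b h k} → a ≈ b → h ≋ k → (a ⊙ h) ≋ (b ⊙ k)
  ⊙-cong a≈b h≋k m = *-cong a≈b (h≋k m)

  ⊙-assoc : ∀ a b h → (a ⊙ (b ⊙ h)) ≋ ((a * b) ⊙ h)
  ⊙-assoc a b h m = sym (*-assoc _ _ _)

  ⊙-identity : ∀ h → (1# ⊙ h) ≋ h
  ⊙-identity h m = *-identityˡ _

  ⊙-zeroˡ : ∀ h → (0# ⊙ h) ≋ 0ₛ
  ⊙-zeroˡ h m = zeroˡ _

  ⊙-zeroʳ : ∀ a → (a ⊙ 0ₛ) ≋ 0ₛ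
  ⊙-zeroʳ a m = zeroʳ _

  ⊙-distribˡ : ∀ a h k → (a ⊙ (h +ₛ k)) ≋ ((a ⊙ h) +ₛ (a ⊙ k))
  ⊙-distribˡ a h k m = distribˡ _ _ _

  ⊙-distribʳ : ∀ a b h → ((a + b) ⊙ h) ≋ ((a ⊙ h) +ₛ (b ⊙ h))
  ⊙-distribʳ a b h m = distribʳ _ _ _

  ⊙-·ₛˡ : ∀ a h k → ((a ⊙ h) ·ₛ k) ≋ (a ⊙ (h ·ₛ k))
  ⊙-·ₛˡ a h k m = trans (sumF-cong (suc m) (λ i _ → *-assoc _ _ _)) (sym (*-distribˡ-sumF (suc m) a _))

  ⊙-·ₛʳ : ∀ a h k → (h ·ₛ (a ⊙ k)) ≋ (a ⊙ (h ·ₛ k))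
  ⊙-·ₛʳ a h k m = trans (sumF-cong (suc m) (λ i _ → x∙yz≈y∙xz _ _ _)) (sym (*-distribˡ-sumF (suc m) a _))

  ⊙-cancelˡ : ∀ {a h k} → ¬ a ≈ 0# → (a ⊙ h) ≋ (a ⊙ k) → h ≋ k
  ⊙-cancelˡ a≉0 ah≋ak m = *-cancelˡ a≉0 (ah≋ak m)

  dil-cong : ∀ {a b h k} → a ≈ b → h ≋ k → dil a h ≋ dil b k
  dil-cong a≈b h≋k m = *-cong (pow-cong m a≈b) (h≋k m)

  dil-⊙ : ∀ a b h → dil a (b ⊙ h) ≋ (b ⊙ dil a h)
  dil-⊙ a b h m = x∙yz≈y∙xz _ _ _

  dil-dil : ∀ a b h → dil a (dil b h) ≋ dil (a * b) h
  dil-dil a b h m = trans (sym (*-assoc _ _ _)) (*-congʳ (sym (pow-distrib-* a b m)))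

  dil-identity : ∀ h → dil 1# h ≋ h
  dil-identity h m = trans (*-congʳ (pow-1 m)) (*-identityˡ _)

  dil-·ₛ : ∀ a h k → dil a (h ·ₛ k) ≋ (dil a h ·ₛ dil a k)
  dil-·ₛ a h k m = trans (*-distribˡ-sumF (suc m) _ _) (sumF-cong (suc m) (λ i i≤m → begin
    pow a m * (h i * k (m ∸ i))
      ≈⟨ *-congʳ (reflexive (≡.cong (pow a) (≡.sym (ℕₚ.m+[n∸m]≡n (ℕₚ.≤-pred i≤m))))) ⟩
    pow a (i ℕ.+ (m ∸ i)) * (h i * k (m ∸ i))
      ≈⟨ *-congʳ (pow-+ a i (m ∸ i)) ⟩
    (pow a i * pow a (m ∸ i)) * (h i * k (m ∸ i))
      ≈⟨ *-interchange _ _ _ _ ⟩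
    (pow a i * h i) * (pow a (m ∸ i) * k (m ∸ i))
      ∎))

module SeriesSums {c ℓ : Level} (F : Field c ℓ) (q : Field.Carrier F) where
  open Field F
  open PowerSeries F q
  open SeriesAlgebra F q
  open SetoidReasoning ≋-setoid

  +ₛ-rawMonoid : RawMonoid c ℓ
  +ₛ-rawMonoid = record { Carrier = PS ; _≈_ = _≋_ ; _∙_ = _+ₛ_ ; ε = 0ₛ }

  open MonoidMorphisms +ₛ-rawMonoid +ₛ-rawMonoid public
    using () renaming (IsMonoidHomomorphism to IsAdditive)

  isAdditive : ∀ {φ : PS → PS} → (∀ {h k} → h ≋ k → φ h ≋ φ k) →
    (∀ h k → φ (h +ₛ k) ≋ (φ h +ₛ φ k)) → φ 0ₛ ≋ 0ₛ → IsAdditive φ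
  isAdditive φ-cong φ-+ₛ φ-0ₛ = record
    { isMagmaHomomorphism = record { isRelHomomorphism = record { cong = φ-cong } ; homo = φ-+ₛ }
    ; ε-homo = φ-0ₛ
    }

  ·ₛ-additiveˡ : ∀ k → IsAdditive (k ·ₛ_)
  ·ₛ-additiveˡ k = isAdditive (·ₛ-cong (≋-refl {k})) (·ₛ-distribˡ k) (·ₛ-zeroʳ k)

  ·ₛ-additiveʳ : ∀ k → IsAdditive (_·ₛ k)
  ·ₛ-additiveʳ k = isAdditive (λ h≋h′ → ·ₛ-cong h≋h′ (≋-refl {k})) (·ₛ-distribʳ k) (·ₛ-zeroˡ k)

  ⊙-additive : ∀ a → IsAdditive (a ⊙_)
  ⊙-additive a = isAdditive (⊙-cong refl) (⊙-distribˡ a) (⊙-zeroʳ a)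

  dil-additive : ∀ a → IsAdditive (dil a)
  dil-additive a = isAdditive (dil-cong refl) (λ h k m → distribˡ _ _ _) (λ m → zeroʳ _)

  when : Bool → PS → PS
  when b h = if b then h else 0ₛ

  sumOver : ∀ {a} {A : Set a} → (A → PS) → List A → PS
  sumOver T xs = sumList (List.map T xs)

  sumₛ-cong : ∀ n {h k : ℕ → PS} → (∀ i → i < n → h i ≋ k i) → sumₛ n h ≋ sumₛ n k
  sumₛ-cong zero    h≋k = ≋-refl
  sumₛ-cong (suc n) h≋k = +ₛ-cong (sumₛ-cong n (λ i i<n → h≋k i (ℕₚ.m<n⇒m<1+n i<n))) (h≋k n ℕₚ.≤-refl)

  sumₛ-zero : ∀ n {h : ℕ → PS} → (∀ i → i < n → h i ≋ 0ₛ) → sumₛ n h ≋ 0ₛ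
  sumₛ-zero zero    h≋0 = ≋-refl
  sumₛ-zero (suc n) h≋0 =
    ≋-trans (+ₛ-cong (sumₛ-zero n (λ i i<n → h≋0 i (ℕₚ.m<n⇒m<1+n i<n))) (h≋0 n ℕₚ.≤-refl)) (+ₛ-identityˡ 0ₛ)

  sumₛ-distrib-+ₛ : ∀ n (h k : ℕ → PS) → sumₛ n (λ i → h i +ₛ k i) ≋ (sumₛ n h +ₛ sumₛ n k)
  sumₛ-distrib-+ₛ zero    h k = ≋-sym (+ₛ-identityˡ 0ₛ)
  sumₛ-distrib-+ₛ (suc n) h k = ≋-trans (+ₛ-cong (sumₛ-distrib-+ₛ n h k) ≋-refl) (+ₛ-interchange _ _ _ _)

  sumₛ-suc : ∀ n (h : ℕ → PS) → sumₛ (suc n) h ≋ (h 0 +ₛ sumₛ n (λ i → h (suc i)))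
  sumₛ-suc zero    h = ≋-trans (+ₛ-identityˡ (h 0)) (≋-sym (+ₛ-identityʳ (h 0)))
  sumₛ-suc (suc n) h = ≋-trans (+ₛ-cong (sumₛ-suc n h) ≋-refl) (+ₛ-assoc _ _ _)

  sumₛ-extend : ∀ {p n} {h : ℕ → PS} → p ≤′ n → (∀ i → p ≤ i → i < n → h i ≋ 0ₛ) →
    sumₛ n h ≋ sumₛ p h
  sumₛ-extend ≤′-refl            h≋0 = ≋-refl
  sumₛ-extend (≤′-step {n} p≤′n) h≋0 = ≋-trans
    (+ₛ-cong (sumₛ-extend p≤′n (λ i p≤i i<n → h≋0 i p≤i (ℕₚ.m<n⇒m<1+n i<n)))
             (h≋0 n (ℕₚ.≤′⇒≤ p≤′n) ℕₚ.≤-refl))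
    (+ₛ-identityʳ _)

  sumₛ-delta : ∀ {p} n {h : ℕ → PS} → p < n → (∀ i → i < n → i ≢ p → h i ≋ 0ₛ) → sumₛ n h ≋ h p
  sumₛ-delta {p} n {h} p<n h≋0 = begin
    sumₛ n h
      ≈⟨ sumₛ-extend (ℕₚ.≤⇒≤′ p<n) (λ i p<i i<n → h≋0 i i<n (ℕₚ.>⇒≢ p<i)) ⟩
    sumₛ p h +ₛ h p
      ≈⟨ +ₛ-cong (sumₛ-zero p (λ i i<p → h≋0 i (ℕₚ.<-trans i<p p<n) (ℕₚ.<⇒≢ i<p))) ≋-refl ⟩
    0ₛ +ₛ h p
      ≈⟨ +ₛ-identityˡ (h p) ⟩
    h p
      ∎

  when-cong : ∀ b {h k} → h ≋ k → when b h ≋ when b k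
  when-cong true  h≋k = h≋k
  when-cong false h≋k = ≋-refl

  when-true : ∀ {b} h → T b → when b h ≡ h
  when-true {true} h _ = ≡.refl

  when-false : ∀ {b} h → ¬ T b → when b h ≡ 0ₛ
  when-false {false} h _   = ≡.refl
  when-false {true}  h ¬tt = ⊥-elim (¬tt _)

  when-∧ : ∀ b c h → when (b ∧ c) h ≡ when b (when c h)
  when-∧ true  c h = ≡.refl
  when-∧ false c h = ≡.refl

  module _ {φ : PS → PS} (φ-additive : IsAdditive φ) where
    open IsAdditive φ-additive using (homo; ε-homo)

    sumₛ-homo : ∀ n (h : ℕ → PS) → φ (sumₛ n h) ≋ sumₛ n (λ i → φ (h i))
    sumₛ-homo zero    h = ε-homo
    sumₛ-homo (suc n) h = ≋-trans (homo (sumₛ n h) (h n)) (+ₛ-cong (sumₛ-homo n h) ≋-refl)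

    sumOver-homo : ∀ {a} {A : Set a} (T : A → PS) xs → φ (sumOver T xs) ≋ sumOver (λ x → φ (T x)) xs
    sumOver-homo T []       = ε-homo
    sumOver-homo T (x ∷ xs) = ≋-trans (homo (T x) (sumOver T xs)) (+ₛ-cong ≋-refl (sumOver-homo T xs))

    when-homo : ∀ b h → φ (when b h) ≋ when b (φ h)
    when-homo true  h = ≋-refl
    when-homo false h = ε-homo

  module _ {a} {A : Set a} where

    sumOver-cong : ∀ {T U : A → PS} xs → (∀ x → T x ≋ U x) → sumOver T xs ≋ sumOver U xs
    sumOver-cong []       T≋U = ≋-refl
    sumOver-cong (x ∷ xs) T≋U = +ₛ-cong (T≋U x) (sumOver-cong xs T≋U)

    sumOver-zero : ∀ {T : A → PS} xs → (∀ x → T x ≋ 0ₛ) → sumOver T xs ≋ 0ₛ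
    sumOver-zero []       T≋0 = ≋-refl
    sumOver-zero (x ∷ xs) T≋0 = ≋-trans (+ₛ-cong (T≋0 x) (sumOver-zero xs T≋0)) (+ₛ-identityˡ 0ₛ)

    sumOver-++ : ∀ (T : A → PS) xs ys → sumOver T (xs List.++ ys) ≋ (sumOver T xs +ₛ sumOver T ys)
    sumOver-++ T []       ys = ≋-sym (+ₛ-identityˡ _)
    sumOver-++ T (x ∷ xs) ys = ≋-trans (+ₛ-cong ≋-refl (sumOver-++ T xs ys)) (≋-sym (+ₛ-assoc _ _ _))

    sumOver-map : ∀ {b} {B : Set b} (T : A → PS) (f : B → A) xs →
      sumOver T (List.map f xs) ≋ sumOver (λ x → T (f x)) xs
    sumOver-map T f []       = ≋-refl
    sumOver-map T f (x ∷ xs) = +ₛ-cong ≋-refl (sumOver-map T f xs)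

    sumOver-concatMap : ∀ {b} {B : Set b} (T : A → PS) (G : B → List A) xs →
      sumOver T (List.concatMap G xs) ≋ sumOver (λ x → sumOver T (G x)) xs
    sumOver-concatMap T G []       = ≋-refl
    sumOver-concatMap T G (x ∷ xs) =
      ≋-trans (sumOver-++ T (G x) (List.concatMap G xs)) (+ₛ-cong ≋-refl (sumOver-concatMap T G xs))

    sumOver-applyUpTo : ∀ (T : A → PS) (f : ℕ → A) n → sumOver T (List.applyUpTo f n) ≋ sumₛ n (λ i → T (f i))
    sumOver-applyUpTo T f zero    = ≋-refl
    sumOver-applyUpTo T f (suc n) =
      ≋-trans (+ₛ-cong ≋-refl (sumOver-applyUpTo T (λ i → f (suc i)) n)) (≋-sym (sumₛ-suc n (λ i → T (f i))))

    sumOver-filterᵇ : ∀ (T : A → PS) (p : A → Bool) xs →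
      sumOver T (List.filterᵇ p xs) ≋ sumOver (λ x → when (p x) (T x)) xs
    sumOver-filterᵇ T p []       = ≋-refl
    sumOver-filterᵇ T p (x ∷ xs) with p x
    ... | true  = +ₛ-cong ≋-refl (sumOver-filterᵇ T p xs)
    ... | false = ≋-trans (sumOver-filterᵇ T p xs) (≋-sym (+ₛ-identityˡ _))

    sumOver-sumₛ : ∀ n (H : A → ℕ → PS) xs →
      sumOver (λ x → sumₛ n (H x)) xs ≋ sumₛ n (λ i → sumOver (λ x → H x i) xs)
    sumOver-sumₛ n H []       = ≋-sym (sumₛ-zero n (λ i _ → ≋-refl))
    sumOver-sumₛ n H (x ∷ xs) = ≋-trans (+ₛ-cong ≋-refl (sumOver-sumₛ n H xs)) (≋-sym (sumₛ-distrib-+ₛ n (H x) _))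

  sumOver-allVecs : ∀ N m (T : Vec ℕ (suc m) → PS) →
    sumOver T (allVecs N (suc m)) ≋ sumₛ (suc N) (λ k → sumOver (λ ks → T (k ∷ ks)) (allVecs N m))
  sumOver-allVecs N m T = begin
    sumOver T (List.concatMap (λ k → List.map (k ∷_) (allVecs N m)) (List.upTo (suc N)))
      ≈⟨ sumOver-concatMap T (λ k → List.map (k ∷_) (allVecs N m)) (List.upTo (suc N)) ⟩
    sumOver (λ k → sumOver T (List.map (k ∷_) (allVecs N m))) (List.upTo (suc N))
      ≈⟨ sumOver-cong (List.upTo (suc N)) (λ k → sumOver-map T (k ∷_) (allVecs N m)) ⟩
    sumOver (λ k → sumOver (λ ks → T (k ∷ ks)) (allVecs N m)) (List.upTo (suc N))
      ≈⟨ sumOver-applyUpTo _ (λ k → k) (suc N) ⟩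
    sumₛ (suc N) (λ k → sumOver (λ ks → T (k ∷ ks)) (allVecs N m))
      ∎

module QDerivative {c ℓ : Level} (F : Field c ℓ) (q : Field.Carrier F)
    (q≉1 : ¬ Field._≈_ F q (Field.1# F)) where
  open Field F
  open PowerSeries F q
  open FiniteSums F q
  open QIntegers F q
  open SeriesAlgebra F q
  open SeriesSums F q
  open CommSemigroupProperties *-commutativeSemigroup using (x∙yz≈y∙xz; xy∙z≈xz∙y; interchange)
  open RingProperties ring using ([y-z]x≈yx-zx)
  open GroupProperties +-group using (x∙y⁻¹≈ε⇒x≈y)
  open SetoidReasoning setoid

  1-q≉0 : ¬ 1# - q ≈ 0#
  1-q≉0 1-q≈0 = q≉1 (sym (x∙y⁻¹≈ε⇒x≈y 1# q 1-q≈0))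

  Dq-coeff : ∀ h m → Dq h m ≈ [ suc m ]q * h (suc m)
  Dq-coeff h m = begin
    (x - pow q (suc m) * x) * (1# - q) ⁻¹          ≈⟨ *-congʳ (trans ([y-z]x≈yx-zx x 1# _) (+-congʳ (*-identityˡ x))) ⟨
    ((1# - pow q (suc m)) * x) * (1# - q) ⁻¹       ≈⟨ *-congʳ (*-congʳ ([n]q*[1-q]≈1-qⁿ (suc m))) ⟨
    (([ suc m ]q * (1# - q)) * x) * (1# - q) ⁻¹    ≈⟨ *-congʳ (xy∙z≈xz∙y _ _ _) ⟩
    (([ suc m ]q * x) * (1# - q)) * (1# - q) ⁻¹    ≈⟨ *-assoc _ _ _ ⟩
    ([ suc m ]q * x) * ((1# - q) * (1# - q) ⁻¹)    ≈⟨ *-congˡ (inverseʳ _ 1-q≉0) ⟩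
    ([ suc m ]q * x) * 1#                          ≈⟨ *-identityʳ _ ⟩
    [ suc m ]q * x                                 ∎
    where
    x : Carrier
    x = h (suc m)

  Dq-cong : ∀ {h k} → h ≋ k → Dq h ≋ Dq k
  Dq-cong h≋k m = *-congʳ (+-cong (h≋k (suc m)) (-‿cong (*-congˡ (h≋k (suc m)))))

  Dq-additive : IsAdditive Dq
  Dq-additive = isAdditive Dq-cong
    (λ h k m → trans (Dq-coeff (h +ₛ k) m) (trans (distribˡ _ _ _) (sym (+-cong (Dq-coeff h m) (Dq-coeff k m)))))
    (λ m → trans (Dq-coeff 0ₛ m) (zeroʳ _))

  Dq-⊙ : ∀ a h → Dq (a ⊙ h) ≋ (a ⊙ Dq h)
  Dq-⊙ a h m = begin
    Dq (a ⊙ h) m                  ≈⟨ Dq-coeff (a ⊙ h) m ⟩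
    [ suc m ]q * (a * h (suc m))  ≈⟨ x∙yz≈y∙xz _ _ _ ⟩
    a * ([ suc m ]q * h (suc m))  ≈⟨ *-congˡ (Dq-coeff h m) ⟨
    a * Dq h m                    ∎

  Dq-dil : ∀ a h → Dq (dil a h) ≋ (a ⊙ dil a (Dq h))
  Dq-dil a h m = begin
    Dq (dil a h) m                                ≈⟨ Dq-coeff (dil a h) m ⟩
    [ suc m ]q * (pow a (suc m) * h (suc m))      ≈⟨ x∙yz≈y∙xz _ _ _ ⟩
    pow a (suc m) * ([ suc m ]q * h (suc m))      ≈⟨ *-congˡ (Dq-coeff h m) ⟨
    (a * pow a m) * Dq h m                        ≈⟨ *-assoc _ _ _ ⟩
    a * (pow a m * Dq h m)                        ∎

  Dq-leibniz : ∀ u v → Dq (u ·ₛ v) ≋ ((Dq u ·ₛ dil q v) +ₛ (u ·ₛ Dq v))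
  Dq-leibniz u v m = begin
    Dq (u ·ₛ v) m
      ≈⟨ Dq-coeff (u ·ₛ v) m ⟩
    [ suc m ]q * sumF (suc (suc m)) w
      ≈⟨ *-distribˡ-sumF (suc (suc m)) _ _ ⟩
    sumF (suc (suc m)) (λ i → [ suc m ]q * w i)
      ≈⟨ sumF-cong (suc (suc m)) (λ i i≤ → trans (*-congʳ (split (ℕₚ.≤-pred i≤))) (distribʳ _ _ _)) ⟩
    sumF (suc (suc m)) (λ i → [ suc m ∸ i ]q * w i + (pow q (suc m ∸ i) * [ i ]q) * w i)
      ≈⟨ sumF-distrib-+ (suc (suc m)) _ _ ⟩
    sumF (suc (suc m)) (λ i → [ suc m ∸ i ]q * w i) + sumF (suc (suc m)) (λ i → (pow q (suc m ∸ i) * [ i ]q) * w i)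
      ≈⟨ +-comm _ _ ⟩
    sumF (suc (suc m)) (λ i → (pow q (suc m ∸ i) * [ i ]q) * w i) + sumF (suc (suc m)) (λ i → [ suc m ∸ i ]q * w i)
      ≈⟨ +-cong Dq-on-left Dq-on-right ⟩
    ((Dq u ·ₛ dil q v) +ₛ (u ·ₛ Dq v)) m
      ∎
    where
    w : ℕ → Carrier
    w i = u i * v (suc m ∸ i)

    split : ∀ {i} → i ≤ suc m → [ suc m ]q ≈ [ suc m ∸ i ]q + pow q (suc m ∸ i) * [ i ]q
    split {i} i≤ = trans (reflexive (≡.cong [_]q (≡.sym (ℕₚ.m∸n+n≡m i≤)))) ([+]q (suc m ∸ i) i)

    Dq-on-left : sumF (suc (suc m)) (λ i → (pow q (suc m ∸ i) * [ i ]q) * w i) ≈ (Dq u ·ₛ dil q v) m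
    Dq-on-left = begin
      sumF (suc (suc m)) (λ i → (pow q (suc m ∸ i) * [ i ]q) * w i)
        ≈⟨ sumF-suc (suc m) _ ⟩
      (pow q (suc m) * 0#) * w 0 + sumF (suc m) (λ i → (pow q (m ∸ i) * [ suc i ]q) * (u (suc i) * v (m ∸ i)))
        ≈⟨ +-cong (trans (*-congʳ (zeroʳ _)) (zeroˡ _)) (sumF-cong (suc m) (λ i _ → xy∙zw≈yz∙xw _ _ _ _)) ⟩
      0# + sumF (suc m) (λ i → ([ suc i ]q * u (suc i)) * (pow q (m ∸ i) * v (m ∸ i)))
        ≈⟨ +-identityˡ _ ⟩
      sumF (suc m) (λ i → ([ suc i ]q * u (suc i)) * (pow q (m ∸ i) * v (m ∸ i)))
        ≈⟨ sumF-cong (suc m) (λ i _ → *-congʳ (Dq-coeff u i)) ⟨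
      (Dq u ·ₛ dil q v) m
        ∎
      where
      xy∙zw≈yz∙xw : ∀ x y z w → (x * y) * (z * w) ≈ (y * z) * (x * w)
      xy∙zw≈yz∙xw x y z w = trans (*-congʳ (*-comm x y)) (interchange y x z w)

    Dq-on-right : sumF (suc (suc m)) (λ i → [ suc m ∸ i ]q * w i) ≈ (u ·ₛ Dq v) m
    Dq-on-right = begin
      sumF (suc m) (λ i → [ suc m ∸ i ]q * w i) + [ suc m ∸ suc m ]q * w (suc m)
        ≈⟨ +-cong (sumF-cong (suc m) (λ i i≤m →
                    reflexive (≡.cong (λ t → [ t ]q * (u i * v t)) (ℕₚ.+-∸-assoc 1 (ℕₚ.≤-pred i≤m)))))
                  (trans (*-congʳ (reflexive (≡.cong [_]q (ℕₚ.n∸n≡0 m)))) (zeroˡ _)) ⟩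
      sumF (suc m) (λ i → [ suc (m ∸ i) ]q * (u i * v (suc (m ∸ i)))) + 0#
        ≈⟨ +-identityʳ _ ⟩
      sumF (suc m) (λ i → [ suc (m ∸ i) ]q * (u i * v (suc (m ∸ i))))
        ≈⟨ sumF-cong (suc m) (λ i _ → trans (x∙yz≈y∙xz _ _ _) (*-congˡ (sym (Dq-coeff v (m ∸ i))))) ⟩
      (u ·ₛ Dq v) m
        ∎

module DividedDerivatives {c ℓ : Level} (F : Field c ℓ) (q : Field.Carrier F)
    (q≉1 : ¬ Field._≈_ F q (Field.1# F))
    ([m]q≉0 : ∀ m → 1 ≤ m → ¬ Field._≈_ F (PowerSeries.[_]q F q m) (Field.0# F)) where
  open Field F
  open PowerSeries F q
  open FieldProperties F
  open QIntegers F q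
  open SeriesAlgebra F q
  open SeriesSums F q
  open QDerivative F q q≉1
  open CommSemigroupProperties *-commutativeSemigroup using (x∙yz≈yx∙z)
  open SetoidReasoning ≋-setoid

  [suc]q≉0 : ∀ k → ¬ [ suc k ]q ≈ 0#
  [suc]q≉0 k = [m]q≉0 (suc k) (s≤s z≤n)

  [_]q!≉0 : ∀ k → ¬ [ k ]q! ≈ 0#
  [ zero  ]q!≉0 = 1≉0
  [ suc k ]q!≉0 = *-nonzero ([suc]q≉0 k) [ k ]q!≉0

  [k]q!⁻¹≈[1+k]q*[1+k]q!⁻¹ : ∀ k → [ k ]q! ⁻¹ ≈ [ suc k ]q * [ suc k ]q! ⁻¹
  [k]q!⁻¹≈[1+k]q*[1+k]q!⁻¹ k = sym (⁻¹-unique [ k ]q!≉0 (trans (x∙yz≈yx∙z _ _ _) (inverseʳ _ [ suc k ]q!≉0)))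

  divDq : ℕ → PS → PS
  divDq k h = ([ k ]q! ⁻¹) ⊙ Dq^ k h

  divDq-zero : ∀ h → divDq 0 h ≋ h
  divDq-zero h = ≋-trans (⊙-cong 1⁻¹≈1 ≋-refl) (⊙-identity h)

  Dq-divDq : ∀ k h → Dq (divDq k h) ≋ ([ suc k ]q ⊙ divDq (suc k) h)
  Dq-divDq k h = begin
    Dq (([ k ]q! ⁻¹) ⊙ Dq^ k h)                          ≈⟨ Dq-⊙ _ (Dq^ k h) ⟩
    ([ k ]q! ⁻¹) ⊙ Dq^ (suc k) h                         ≈⟨ ⊙-cong ([k]q!⁻¹≈[1+k]q*[1+k]q!⁻¹ k) ≋-refl ⟩
    ([ suc k ]q * [ suc k ]q! ⁻¹) ⊙ Dq^ (suc k) h        ≈⟨ ⊙-assoc _ _ _ ⟨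
    [ suc k ]q ⊙ divDq (suc k) h                         ∎

  divDq-Dq : ∀ k h → divDq k (Dq h) ≋ ([ suc k ]q ⊙ divDq (suc k) h)
  divDq-Dq k h = ≋-trans (⊙-cong refl (≋-reflexive (Dq^-Dq k))) (≋-trans (≋-sym (Dq-⊙ _ (Dq^ k h))) (Dq-divDq k h))
    where
    Dq^-Dq : ∀ k → Dq^ k (Dq h) ≡ Dq (Dq^ k h)
    Dq^-Dq zero    = ≡.refl
    Dq^-Dq (suc k) = ≡.cong Dq (Dq^-Dq k)

  sumₛ-q-pascal : ∀ b (T : ℕ → PS) →
    sumₛ b (λ k → ([ suc k ]q ⊙ T (suc k)) +ₛ ((pow q k * [ b ∸ k ]q) ⊙ T k)) ≋ ([ b ]q ⊙ sumₛ (suc b) T)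
  sumₛ-q-pascal b T = begin
    sumₛ b (λ k → ([ suc k ]q ⊙ T (suc k)) +ₛ (coeff k ⊙ T k))
      ≈⟨ sumₛ-distrib-+ₛ b _ _ ⟩
    sumₛ b (λ k → [ suc k ]q ⊙ T (suc k)) +ₛ sumₛ b (λ k → coeff k ⊙ T k)
      ≈⟨ +ₛ-cong shift extend ⟩
    sumₛ (suc b) (λ k → [ k ]q ⊙ T k) +ₛ sumₛ (suc b) (λ k → coeff k ⊙ T k)
      ≈⟨ sumₛ-distrib-+ₛ (suc b) _ _ ⟨
    sumₛ (suc b) (λ k → ([ k ]q ⊙ T k) +ₛ (coeff k ⊙ T k))
      ≈⟨ sumₛ-cong (suc b) (λ k k≤b →
           ≋-trans (≋-sym (⊙-distribʳ _ _ (T k))) (⊙-cong (split (ℕₚ.≤-pred k≤b)) ≋-refl)) ⟩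
    sumₛ (suc b) (λ k → [ b ]q ⊙ T k)
      ≈⟨ sumₛ-homo (⊙-additive [ b ]q) (suc b) T ⟨
    [ b ]q ⊙ sumₛ (suc b) T
      ∎
    where
    coeff : ℕ → Carrier
    coeff k = pow q k * [ b ∸ k ]q

    split : ∀ {k} → k ≤ b → [ k ]q + coeff k ≈ [ b ]q
    split {k} k≤b = trans (sym ([+]q k (b ∸ k))) (reflexive (≡.cong [_]q (ℕₚ.m+[n∸m]≡n k≤b)))

    shift : sumₛ b (λ k → [ suc k ]q ⊙ T (suc k)) ≋ sumₛ (suc b) (λ k → [ k ]q ⊙ T k)
    shift = ≋-sym (≋-trans (sumₛ-suc b _) (≋-trans (+ₛ-cong (⊙-zeroˡ (T 0)) ≋-refl) (+ₛ-identityˡ _)))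

    extend : sumₛ b (λ k → coeff k ⊙ T k) ≋ sumₛ (suc b) (λ k → coeff k ⊙ T k)
    extend = ≋-sym (≋-trans (+ₛ-cong ≋-refl last≋0) (+ₛ-identityʳ _))
      where
      last≋0 : (coeff b ⊙ T b) ≋ 0ₛ
      last≋0 = ≋-trans (⊙-cong (trans (*-congˡ (reflexive (≡.cong [_]q (ℕₚ.n∸n≡0 b)))) (zeroʳ _)) ≋-refl)
                       (⊙-zeroˡ (T b))

  leibnizTerm : PS → PS → ℕ → ℕ → PS
  leibnizTerm u v a k = divDq k u ·ₛ dil (pow q k) (divDq (a ∸ k) v)

  Dq-leibnizTerm : ∀ u v {a k} → k ≤ a → Dq (leibnizTerm u v a k) ≋
    (([ suc k ]q ⊙ leibnizTerm u v (suc a) (suc k)) +ₛ ((pow q k * [ suc a ∸ k ]q) ⊙ leibnizTerm u v (suc a) k))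
  Dq-leibnizTerm u v {a} {k} k≤a = begin
    Dq (U ·ₛ dil (pow q k) V)
      ≈⟨ Dq-leibniz U (dil (pow q k) V) ⟩
    (Dq U ·ₛ dil q (dil (pow q k) V)) +ₛ (U ·ₛ Dq (dil (pow q k) V))
      ≈⟨ +ₛ-cong (·ₛ-cong (Dq-divDq k u) (dil-dil q (pow q k) V)) (·ₛ-cong ≋-refl (Dq-dil (pow q k) V)) ⟩
    (([ suc k ]q ⊙ U′) ·ₛ dil (pow q (suc k)) V) +ₛ (U ·ₛ (pow q k ⊙ dil (pow q k) (Dq V)))
      ≈⟨ +ₛ-cong (⊙-·ₛˡ [ suc k ]q U′ (dil (pow q (suc k)) V))
                 (·ₛ-cong ≋-refl (⊙-cong refl (dil-cong refl (Dq-divDq (a ∸ k) v)))) ⟩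
    ([ suc k ]q ⊙ leibnizTerm u v (suc a) (suc k)) +ₛ (U ·ₛ (pow q k ⊙ dil (pow q k) ([ suc (a ∸ k) ]q ⊙ V′)))
      ≈⟨ +ₛ-cong ≋-refl (·ₛ-cong ≋-refl (≋-trans (⊙-cong refl (dil-⊙ _ _ V′)) (⊙-assoc _ _ _))) ⟩
    ([ suc k ]q ⊙ leibnizTerm u v (suc a) (suc k)) +ₛ (U ·ₛ ((pow q k * [ suc (a ∸ k) ]q) ⊙ dil (pow q k) V′))
      ≈⟨ +ₛ-cong ≋-refl (⊙-·ₛʳ (pow q k * [ suc (a ∸ k) ]q) U (dil (pow q k) V′)) ⟩
    ([ suc k ]q ⊙ leibnizTerm u v (suc a) (suc k)) +ₛ ((pow q k * [ suc (a ∸ k) ]q) ⊙ (U ·ₛ dil (pow q k) V′))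
      ≡⟨ ≡.cong (λ t → ([ suc k ]q ⊙ leibnizTerm u v (suc a) (suc k)) +ₛ
                       ((pow q k * [ t ]q) ⊙ (U ·ₛ dil (pow q k) (divDq t v))))
                (≡.sym (ℕₚ.+-∸-assoc 1 k≤a)) ⟩
    ([ suc k ]q ⊙ leibnizTerm u v (suc a) (suc k)) +ₛ ((pow q k * [ suc a ∸ k ]q) ⊙ leibnizTerm u v (suc a) k)
      ∎
    where
    U U′ V V′ : PS
    U  = divDq k u
    U′ = divDq (suc k) u
    V  = divDq (a ∸ k) v
    V′ = divDq (suc (a ∸ k)) v

  divDq-leibniz : ∀ a u v → divDq a (u ·ₛ v) ≋ sumₛ (suc a) (leibnizTerm u v a)
  divDq-leibniz zero u v = begin
    divDq 0 (u ·ₛ v)                 ≈⟨ divDq-zero (u ·ₛ v) ⟩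
    u ·ₛ v                           ≈⟨ ·ₛ-cong (divDq-zero u) (≋-trans (dil-identity _) (divDq-zero v)) ⟨
    divDq 0 u ·ₛ dil 1# (divDq 0 v)  ≈⟨ +ₛ-identityˡ _ ⟨
    sumₛ 1 (leibnizTerm u v 0)       ∎
  divDq-leibniz (suc a) u v = ⊙-cancelˡ ([suc]q≉0 a) (begin
    [ suc a ]q ⊙ divDq (suc a) (u ·ₛ v)
      ≈⟨ Dq-divDq a (u ·ₛ v) ⟨
    Dq (divDq a (u ·ₛ v))
      ≈⟨ Dq-cong (divDq-leibniz a u v) ⟩
    Dq (sumₛ (suc a) (leibnizTerm u v a))
      ≈⟨ sumₛ-homo Dq-additive (suc a) (leibnizTerm u v a) ⟩
    sumₛ (suc a) (λ k → Dq (leibnizTerm u v a k))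
      ≈⟨ sumₛ-cong (suc a) (λ k k≤a → Dq-leibnizTerm u v (ℕₚ.≤-pred k≤a)) ⟩
    sumₛ (suc a) (λ k → ([ suc k ]q ⊙ leibnizTerm u v (suc a) (suc k)) +ₛ
                        ((pow q k * [ suc a ∸ k ]q) ⊙ leibnizTerm u v (suc a) k))
      ≈⟨ sumₛ-q-pascal (suc a) (leibnizTerm u v (suc a)) ⟩
    [ suc a ]q ⊙ sumₛ (suc (suc a)) (leibnizTerm u v (suc a))
      ∎)

  infix 30 _⟪_,_⟫
  _⟪_,_⟫ : PS → ℕ → ℕ → PS
  h ⟪ a , c ⟫ = ([ a ]q! ⁻¹) ⊙ (h ⟨ a , c ⟩)

  ⟪⟫≋dil-divDq : ∀ h a c → h ⟪ a , c ⟫ ≋ dil (pow q c) (divDq a h)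
  ⟪⟫≋dil-divDq h a c = ≋-sym (dil-⊙ (pow q c) _ (Dq^ a h))

  Dq≋⟪1,0⟫ : ∀ h → Dq h ≋ h ⟪ 1 , 0 ⟫
  Dq≋⟪1,0⟫ h = ≋-sym (≋-trans (⊙-cong [1]q!⁻¹≈1 (dil-identity (Dq h))) (⊙-identity (Dq h)))
    where
    [1]q!⁻¹≈1 : [ 1 ]q! ⁻¹ ≈ 1#
    [1]q!⁻¹≈1 = sym (⁻¹-unique [ 1 ]q!≉0 (trans (*-identityʳ _) (trans (*-identityʳ _) (+-identityˡ 1#))))

  gDq-⟪⟫ : ∀ g h a c → gDq g h ⟪ a , c ⟫ ≋
    sumₛ (suc a) (λ k → ([ suc (a ∸ k) ]q ⊙ g ⟪ k , c ⟫) ·ₛ h ⟪ suc (a ∸ k) , c ℕ.+ k ⟫)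
  gDq-⟪⟫ g h a c = begin
    gDq g h ⟪ a , c ⟫
      ≈⟨ ⟪⟫≋dil-divDq (g ·ₛ Dq h) a c ⟩
    dil (pow q c) (divDq a (g ·ₛ Dq h))
      ≈⟨ dil-cong refl (divDq-leibniz a g (Dq h)) ⟩
    dil (pow q c) (sumₛ (suc a) (leibnizTerm g (Dq h) a))
      ≈⟨ sumₛ-homo (dil-additive (pow q c)) (suc a) (leibnizTerm g (Dq h) a) ⟩
    sumₛ (suc a) (λ k → dil (pow q c) (leibnizTerm g (Dq h) a k))
      ≈⟨ sumₛ-cong (suc a) (λ k _ → dilated-term k) ⟩
    sumₛ (suc a) (λ k → ([ suc (a ∸ k) ]q ⊙ g ⟪ k , c ⟫) ·ₛ h ⟪ suc (a ∸ k) , c ℕ.+ k ⟫)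
      ∎
    where
    dilated-term : ∀ k → dil (pow q c) (leibnizTerm g (Dq h) a k) ≋
                         (([ suc (a ∸ k) ]q ⊙ g ⟪ k , c ⟫) ·ₛ h ⟪ suc (a ∸ k) , c ℕ.+ k ⟫)
    dilated-term k = begin
      dil (pow q c) (divDq k g ·ₛ dil (pow q k) (divDq j (Dq h)))
        ≈⟨ dil-·ₛ (pow q c) (divDq k g) (dil (pow q k) (divDq j (Dq h))) ⟩
      dil (pow q c) (divDq k g) ·ₛ dil (pow q c) (dil (pow q k) (divDq j (Dq h)))
        ≈⟨ ·ₛ-cong (≋-sym (⟪⟫≋dil-divDq g k c))
                   (≋-trans (dil-dil _ _ _) (dil-cong (sym (pow-+ q c k)) (divDq-Dq j h))) ⟩
      g ⟪ k , c ⟫ ·ₛ dil (pow q (c ℕ.+ k)) ([ suc j ]q ⊙ divDq (suc j) h)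
        ≈⟨ ·ₛ-cong ≋-refl (≋-trans (dil-⊙ _ _ _) (⊙-cong refl (≋-sym (⟪⟫≋dil-divDq h (suc j) (c ℕ.+ k))))) ⟩
      g ⟪ k , c ⟫ ·ₛ ([ suc j ]q ⊙ h ⟪ suc j , c ℕ.+ k ⟫)
        ≈⟨ ⊙-·ₛʳ [ suc j ]q (g ⟪ k , c ⟫) (h ⟪ suc j , c ℕ.+ k ⟫) ⟩
      [ suc j ]q ⊙ (g ⟪ k , c ⟫ ·ₛ h ⟪ suc j , c ℕ.+ k ⟫)
        ≈⟨ ⊙-·ₛˡ [ suc j ]q (g ⟪ k , c ⟫) (h ⟪ suc j , c ℕ.+ k ⟫) ⟨
      ([ suc j ]q ⊙ g ⟪ k , c ⟫) ·ₛ h ⟪ suc j , c ℕ.+ k ⟫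
        ∎
      where
      j : ℕ
      j = a ∸ k

module Expansion {c ℓ : Level} (F : Field c ℓ) (q : Field.Carrier F)
    (q≉1 : ¬ Field._≈_ F q (Field.1# F))
    ([m]q≉0 : ∀ m → 1 ≤ m → ¬ Field._≈_ F (PowerSeries.[_]q F q m) (Field.0# F))
    (f g : PowerSeries.PS F q) where
  open Field F
  open PowerSeries F q
  open SeriesAlgebra F q
  open SeriesSums F q
  open DividedDerivatives F q q≉1 [m]q≉0
  open SetoidReasoning ≋-setoid

  leaf : ℕ → ℕ → ∀ {m} → Vec ℕ m → PS
  leaf j K []       = f ⟪ j ∸ K , K ⟫
  leaf j K (k ∷ ks) = leaf (suc j) (K ℕ.+ k) ks

  summand : ℕ → ℕ → ∀ {m} → Vec ℕ m → PS
  summand j K ks = when (prefixOK j K ks) (term g j K ks ·ₛ leaf j K ks)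

  -- allVecs N only enumerates entries ≤ N; the bound j + m ≤ 1 + N makes sure no admissible entry is missed.
  gDq^-⟪⟫-expansion : ∀ N m j K → K ≤ j → j ℕ.+ m ≤ suc N →
    gDq^ m g f ⟪ j ∸ K , K ⟫ ≋ sumOver (summand j K) (allVecs N m)
  gDq^-⟪⟫-expansion N zero j K K≤j _ =
    ≋-sym (≋-trans (+ₛ-identityʳ _) (·ₛ-identityˡ (f ⟪ j ∸ K , K ⟫)))
  gDq^-⟪⟫-expansion N (suc m) j K K≤j j+m+1≤N+1 = begin
    gDq^ (suc m) g f ⟪ a , K ⟫
      ≈⟨ gDq-⟪⟫ g (gDq^ m g f) a K ⟩
    sumₛ (suc a) (λ k → ([ suc (a ∸ k) ]q ⊙ g ⟪ k , K ⟫) ·ₛ gDq^ m g f ⟪ suc (a ∸ k) , K ℕ.+ k ⟫)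
      ≈⟨ sumₛ-cong (suc a) (λ k k≤a → expand-term (ℕₚ.≤-pred k≤a)) ⟩
    sumₛ (suc a) (λ k → sumOver (λ ks → summand j K (k ∷ ks)) (allVecs N m))
      ≈⟨ sumₛ-extend (ℕₚ.≤⇒≤′ (s≤s a≤N))
           (λ k a<k _ → sumOver-zero (allVecs N m) (λ ks → ≋-reflexive (first-entry-fails a<k ks))) ⟨
    sumₛ (suc N) (λ k → sumOver (λ ks → summand j K (k ∷ ks)) (allVecs N m))
      ≈⟨ sumOver-allVecs N m (summand j K) ⟨
    sumOver (summand j K) (allVecs N (suc m))
      ∎
    where
    a : ℕ
    a = j ∸ K

    j+m≤N : j ℕ.+ m ≤ N
    j+m≤N = ℕₚ.≤-pred (≡.subst (_≤ suc N) (ℕₚ.+-suc j m) j+m+1≤N+1)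

    a≤N : a ≤ N
    a≤N = ℕₚ.≤-trans (ℕₚ.m∸n≤m j K) (ℕₚ.≤-trans (ℕₚ.m≤m+n j m) j+m≤N)

    first-entry-fails : ∀ {k} → a < k → ∀ ks → summand j K (k ∷ ks) ≡ 0ₛ
    first-entry-fails {k} a<k ks =
      ≡.trans (when-∧ (K ℕ.+ k ≤ᵇ j) _ _) (when-false _ (λ K+k≤ᵇj → ℕₚ.<⇒≱ a<k (k≤a K+k≤ᵇj)))
      where
      k≤a : T (K ℕ.+ k ≤ᵇ j) → k ≤ a
      k≤a K+k≤ᵇj = ℕₚ.m+n≤o⇒m≤o∸n k (≡.subst (_≤ j) (ℕₚ.+-comm K k) (ℕₚ.≤ᵇ⇒≤ (K ℕ.+ k) j K+k≤ᵇj))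

    expand-term : ∀ {k} → k ≤ a →
      (([ suc (a ∸ k) ]q ⊙ g ⟪ k , K ⟫) ·ₛ gDq^ m g f ⟪ suc (a ∸ k) , K ℕ.+ k ⟫) ≋
      sumOver (λ ks → summand j K (k ∷ ks)) (allVecs N m)
    expand-term {k} k≤a = begin
      ([ suc (a ∸ k) ]q ⊙ g ⟪ k , K ⟫) ·ₛ gDq^ m g f ⟪ suc (a ∸ k) , K′ ⟫
        ≡⟨ ≡.cong (λ t → ([ t ]q ⊙ g ⟪ k , K ⟫) ·ₛ gDq^ m g f ⟪ t , K′ ⟫) index ⟩
      ([ suc j ∸ K′ ]q ⊙ g ⟪ k , K ⟫) ·ₛ gDq^ m g f ⟪ suc j ∸ K′ , K′ ⟫
        ≈⟨ ·ₛ-cong (⊙-assoc _ _ _) (gDq^-⟪⟫-expansion N m (suc j) K′ (ℕₚ.m≤n⇒m≤1+n K′≤j) (s≤s j+m≤N)) ⟩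
      w ·ₛ sumOver (summand (suc j) K′) (allVecs N m)
        ≈⟨ sumOver-homo (·ₛ-additiveˡ w) (summand (suc j) K′) (allVecs N m) ⟩
      sumOver (λ ks → w ·ₛ summand (suc j) K′ ks) (allVecs N m)
        ≈⟨ sumOver-cong (allVecs N m) prepend ⟩
      sumOver (λ ks → summand j K (k ∷ ks)) (allVecs N m)
        ∎
      where
      K′ : ℕ
      K′ = K ℕ.+ k

      K′≤j : K′ ≤ j
      K′≤j = ≡.subst (_≤ j) (ℕₚ.+-comm k K) (ℕₚ.m≤o∸n⇒m+n≤o k K≤j k≤a)

      index : suc (a ∸ k) ≡ suc j ∸ K′
      index = ≡.sym (≡.trans (ℕₚ.+-∸-assoc 1 K′≤j) (≡.cong suc (≡.sym (ℕₚ.∸-+-assoc j K k))))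

      w : PS
      w = ([ suc j ∸ K′ ]q * [ k ]q! ⁻¹) ⊙ (g ⟨ k , K ⟩)

      prepend : ∀ ks → (w ·ₛ summand (suc j) K′ ks) ≋ summand j K (k ∷ ks)
      prepend ks = begin
        w ·ₛ when p (term g (suc j) K′ ks ·ₛ leaf (suc j) K′ ks)
          ≈⟨ when-homo (·ₛ-additiveˡ w) p _ ⟩
        when p (w ·ₛ (term g (suc j) K′ ks ·ₛ leaf (suc j) K′ ks))
          ≈⟨ when-cong p (·ₛ-assoc w (term g (suc j) K′ ks) (leaf (suc j) K′ ks)) ⟨
        when p ((w ·ₛ term g (suc j) K′ ks) ·ₛ leaf (suc j) K′ ks)
          ≡⟨ ≡.trans (when-∧ (K′ ≤ᵇ j) p _) (when-true _ (ℕₚ.≤⇒≤ᵇ K′≤j)) ⟨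
        summand j K (k ∷ ks)
          ∎
        where
        p : Bool
        p = prefixOK (suc j) K′ ks

  leaf≡ : ∀ j K {m} (ks : Vec ℕ m) → leaf j K ks ≡ f ⟪ (j ℕ.+ m) ∸ (K ℕ.+ vsum ks) , K ℕ.+ vsum ks ⟫
  leaf≡ j K []       =
    ≡.cong₂ (λ j′ K′ → f ⟪ j′ ∸ K′ , K′ ⟫) (≡.sym (ℕₚ.+-identityʳ j)) (≡.sym (ℕₚ.+-identityʳ K))
  leaf≡ j K {suc m} (k ∷ ks) = ≡.trans (leaf≡ (suc j) (K ℕ.+ k) ks)
    (≡.cong₂ (λ j′ K′ → f ⟪ j′ ∸ K′ , K′ ⟫) (≡.sym (ℕₚ.+-suc j m)) (ℕₚ.+-assoc K k (vsum ks)))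

  prefixOK⇒vsum≤ : ∀ j K {m} (ks : Vec ℕ m) → K ≤ j → T (prefixOK (suc j) K ks) → K ℕ.+ vsum ks ≤ j ℕ.+ m
  prefixOK⇒vsum≤ j K []       K≤j _ = ℕₚ.+-mono-≤ K≤j z≤n
  prefixOK⇒vsum≤ j K {suc m} (k ∷ ks) _ ok with Equivalence.to T-∧ ok
  ... | K+k≤ᵇ1+j , ok′ = ≡.subst₂ _≤_ (ℕₚ.+-assoc K k (vsum ks)) (≡.sym (ℕₚ.+-suc j m))
    (prefixOK⇒vsum≤ (suc j) (K ℕ.+ k) ks (ℕₚ.≤ᵇ⇒≤ (K ℕ.+ k) (suc j) K+k≤ᵇ1+j) ok′)

  summand-by-degree : ∀ n′ (ks : Vec ℕ n′) → summand 1 0 ks ≋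
    sumₛ (suc n′) (λ i → when (admissible (suc n′) (suc i) ks) (term g 1 0 ks ·ₛ f ⟪ suc i , suc n′ ∸ suc i ⟫))
  summand-by-degree n′ ks with prefixOK 1 0 ks in ok
  ... | false = ≋-sym (sumₛ-zero (suc n′) (λ i _ → ≋-reflexive
    (≡.cong (λ b → when b (term g 1 0 ks ·ₛ f ⟪ suc i , n′ ∸ i ⟫)) (∧-zeroʳ (vsum ks ≡ᵇ n′ ∸ i)))))
  ... | true  = begin
    term g 1 0 ks ·ₛ leaf 1 0 ks
      ≡⟨ ≡.cong (term g 1 0 ks ·ₛ_) (≡.trans (leaf≡ 1 0 ks)
           (≡.cong₂ (λ a c → f ⟪ a , c ⟫) (ℕₚ.+-∸-assoc 1 v≤n′) (≡.sym n′∸[n′∸v]≡v))) ⟩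
    candidate (n′ ∸ v)
      ≡⟨ when-true (candidate (n′ ∸ v)) (ℕₚ.≡⇒≡ᵇ v (n′ ∸ (n′ ∸ v)) (≡.sym n′∸[n′∸v]≡v)) ⟨
    selected (n′ ∸ v)
      ≈⟨ sumₛ-delta (suc n′) (s≤s (ℕₚ.m∸n≤m n′ v)) off-diagonal ⟨
    sumₛ (suc n′) selected
      ≈⟨ sumₛ-cong (suc n′) (λ i _ → ≋-reflexive
           (≡.cong (λ b → when b (candidate i)) (≡.sym (∧-identityʳ (v ≡ᵇ n′ ∸ i))))) ⟩
    sumₛ (suc n′) (λ i → when ((v ≡ᵇ n′ ∸ i) ∧ true) (candidate i))
      ∎
    where
    v : ℕ
    v = vsum ks

    v≤n′ : v ≤ n′
    v≤n′ = prefixOK⇒vsum≤ 0 0 ks z≤n (≡.subst T (≡.sym ok) _)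

    n′∸[n′∸v]≡v : n′ ∸ (n′ ∸ v) ≡ v
    n′∸[n′∸v]≡v = ℕₚ.m∸[m∸n]≡n v≤n′

    candidate selected : ℕ → PS
    candidate i = term g 1 0 ks ·ₛ f ⟪ suc i , n′ ∸ i ⟫
    selected i = when (v ≡ᵇ n′ ∸ i) (candidate i)

    off-diagonal : ∀ i → i < suc n′ → i ≢ n′ ∸ v → selected i ≋ 0ₛ
    off-diagonal i i≤n′ i≢n′∸v = ≋-reflexive (when-false (candidate i) (λ v≡ᵇn′∸i → i≢n′∸v (≡.sym
      (≡.trans (≡.cong (n′ ∸_) (ℕₚ.≡ᵇ⇒≡ v (n′ ∸ i) v≡ᵇn′∸i)) (ℕₚ.m∸[m∸n]≡n (ℕₚ.≤-pred i≤n′))))))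

  L·ₛf≋g·ₛsumOver : ∀ n k → (L g n k ·ₛ (f ⟨ k , n ∸ k ⟩)) ≋
    (g ·ₛ sumOver (λ ks → term g 1 0 ks ·ₛ f ⟪ k , n ∸ k ⟫) (admissibleSeqs n k))
  L·ₛf≋g·ₛsumOver n k = begin
    (k!⁻¹ ⊙ ((g ⟨ 0 , 0 ⟩) ·ₛ S)) ·ₛ fₖ
      ≈⟨ ·ₛ-cong (⊙-cong refl (·ₛ-cong (dil-identity g) (≋-refl {S}))) (≋-refl {fₖ}) ⟩
    (k!⁻¹ ⊙ (g ·ₛ S)) ·ₛ fₖ
      ≈⟨ ⊙-·ₛˡ k!⁻¹ (g ·ₛ S) fₖ ⟩
    k!⁻¹ ⊙ ((g ·ₛ S) ·ₛ fₖ)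
      ≈⟨ ⊙-cong refl (·ₛ-assoc g S fₖ) ⟩
    k!⁻¹ ⊙ (g ·ₛ (S ·ₛ fₖ))
      ≈⟨ ⊙-·ₛʳ k!⁻¹ g (S ·ₛ fₖ) ⟨
    g ·ₛ (k!⁻¹ ⊙ (S ·ₛ fₖ))
      ≈⟨ ·ₛ-cong ≋-refl (⊙-·ₛʳ k!⁻¹ S fₖ) ⟨
    g ·ₛ (S ·ₛ f ⟪ k , n ∸ k ⟫)
      ≈⟨ ·ₛ-cong ≋-refl (sumOver-homo (·ₛ-additiveʳ (f ⟪ k , n ∸ k ⟫)) (term g 1 0) (admissibleSeqs n k)) ⟩
    g ·ₛ sumOver (λ ks → term g 1 0 ks ·ₛ f ⟪ k , n ∸ k ⟫) (admissibleSeqs n k)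
      ∎
    where
    k!⁻¹ : Carrier
    k!⁻¹ = [ k ]q! ⁻¹
    S fₖ : PS
    S = sumOver (term g 1 0) (admissibleSeqs n k)
    fₖ = f ⟨ k , n ∸ k ⟩

  gDq^-expansion : ∀ n′ →
    gDq^ (suc n′) g f ≋ sumₛ (suc n′) (λ i → L g (suc n′) (suc i) ·ₛ (f ⟨ suc i , suc n′ ∸ suc i ⟩))
  gDq^-expansion n′ = begin
    g ·ₛ Dq (gDq^ n′ g f)
      ≈⟨ ·ₛ-cong ≋-refl (Dq≋⟪1,0⟫ (gDq^ n′ g f)) ⟩
    g ·ₛ gDq^ n′ g f ⟪ 1 , 0 ⟫
      ≈⟨ ·ₛ-cong ≋-refl (gDq^-⟪⟫-expansion n n′ 1 0 z≤n (ℕₚ.n≤1+n n)) ⟩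
    g ·ₛ sumOver (summand 1 0) xs
      ≈⟨ ·ₛ-cong ≋-refl (sumOver-cong xs (summand-by-degree n′)) ⟩
    g ·ₛ sumOver (λ ks → sumₛ n (λ i → A i ks)) xs
      ≈⟨ ·ₛ-cong ≋-refl (sumOver-sumₛ n (λ ks i → A i ks) xs) ⟩
    g ·ₛ sumₛ n (λ i → sumOver (A i) xs)
      ≈⟨ sumₛ-homo (·ₛ-additiveˡ g) n (λ i → sumOver (A i) xs) ⟩
    sumₛ n (λ i → g ·ₛ sumOver (A i) xs)
      ≈⟨ sumₛ-cong n (λ i _ → ·ₛ-cong ≋-refl (sumOver-filterᵇ _ (admissible n (suc i)) xs)) ⟨
    sumₛ n (λ i → g ·ₛ sumOver (λ ks → term g 1 0 ks ·ₛ f ⟪ suc i , n ∸ suc i ⟫) (admissibleSeqs n (suc i)))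
      ≈⟨ sumₛ-cong n (λ i _ → L·ₛf≋g·ₛsumOver n (suc i)) ⟨
    sumₛ n (λ i → L g n (suc i) ·ₛ (f ⟨ suc i , n ∸ suc i ⟩))
      ∎
    where
    n : ℕ
    n = suc n′
    xs : List (Vec ℕ n′)
    xs = allVecs n n′
    A : ℕ → Vec ℕ n′ → PS
    A i ks = when (admissible n (suc i) ks) (term g 1 0 ks ·ₛ f ⟪ suc i , n ∸ suc i ⟫)

mainTheorem11 : ∀ {c ℓ : Level} (F : Field c ℓ) (q : Field.Carrier F) →
    let open Field F
        open PowerSeries F q
    in ¬ (q ≈ 1#) →
       (∀ m → 1 ≤ m → ¬ ([ m ]q ≈ 0#)) →
       ∀ (n : ℕ) → 1 ≤ n → ∀ (f g : PS) →
       gDq^ n g f ≋ sumₛ n (λ i → L g n (suc i) ·ₛ (f ⟨ suc i , n ∸ suc i ⟩))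
mainTheorem11 F q q≉1 [m]q≉0 zero    ()
mainTheorem11 F q q≉1 [m]q≉0 (suc n′) _ f g = Expansion.gDq^-expansion F q q≉1 [m]q≉0 f g n′
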